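{- Let $X\subseteq\mathbb{N}^2$. If $G_n(X)$ is a tournament for each $n\ge1$, then $d_X(\emptyset;n)$ is odd for every $n$. If, in addition, the infinite digraph $G(X)=\bigcup_{n\ge1}G_n(X)$ has no directed odd cycle, then for all $n$ and all $I\subseteq[n-1]$ we have $d_X(I;n)=d(I;n)$ or $d_X(I;n)=d([n-1]\setminus I;n)$.
   Context: $[n]=\{1,\dots,n\}$. For $\pi=\pi_1\cdots\pi_n\in\mathfrak{S}_n$, $\mathrm{XDes}(\pi)=\{i\in[n-1]:(\pi_i,\pi_{i+1})\in X\}$ and $d_X(I;n)$ is the number of $\pi\in\mathfrak{S}_n$ with $\mathrm{XDes}(\pi)=I$. $d(I;n)$ is the number of $\pi\in\mathfrak{S}_n$ with descent set $\{i\in[n-1]:\pi_i>\pi_{i+1}\}$ equal to $I$. $G_n(X)$ is the digraph on $[n]$ with an edge $i\to j$ iff $i\ne j$ and $(i,j)\notin X$; $G(X)$ is the digraph on $\mathbb{N}$ that is the union of all $G_n(X)$. A tournament is a digraph in which for every two distinct vertices exactly one of the two possible directed edges between them is present. -}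

module Defs where

open import Data.Bool using (Bool; true; false; _∧_; not)
open import Data.Nat using (ℕ; zero; suc; _≤_; _<ᵇ_; _≡ᵇ_; _%_)
open import Data.List using (List; []; _∷_; [_]; _++_; map; concatMap; filter; length; upTo)
open import Data.Bool.ListAction using (any)
open import Data.List.Properties using (≡-dec)
import Data.Bool.Properties as BoolP
open import Data.List.Relation.Unary.All using (All)
open import Data.List.Relation.Unary.Unique.Propositional using (Unique)
open import Data.Vec using (toList)
open import Data.Fin.Subset using (Subset)
open import Data.Product using (_×_; ∃-syntax; Σ-syntax)
open import Data.Sum using (_⊎_)
open import Data.Unit using (⊤)
open import Relation.Binary.PropositionalEquality using (_≡_; _≢_)
open import Relation.Nullary using (¬_)

-- A set X ⊆ ℕ² is given by its (Boolean) characteristic function.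
-- Only its values on pairs of positive integers matter.
RelSet : Set
RelSet = ℕ → ℕ → Bool

[_]ₙ : ℕ → List ℕ
[ n ]ₙ = map suc (upTo n)

words : ℕ → ℕ → List (List ℕ)
words n zero = [] ∷ []
words n (suc k) = concatMap (λ w → map (_∷ w) [ n ]ₙ) (words n k)

elem : ℕ → List ℕ → Bool
elem x ys = any (λ y → x ≡ᵇ y) ys

distinct : List ℕ → Bool
distinct [] = true
distinct (x ∷ xs) = not (elem x xs) ∧ distinct xs

perms : ℕ → List (List ℕ)
perms n = filter (λ w → distinct w BoolP.≟ true) (words n n)

-- XDes(π) as the indicator vector (position i ↦ [ (π_i,π_{i+1}) ∈ X ]),
-- i = 1,…,n-1 ; entry number i (0-based i-1) corresponds to position i.
xdes : RelSet → List ℕ → List Bool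
xdes X [] = []
xdes X (a ∷ []) = []
xdes X (a ∷ b ∷ r) = X a b ∷ xdes X (b ∷ r)

-- d_X(I;n) for I ⊆ [n-1], encoded as a Subset (n ∸ 1) (entry k ↔ element k+1)
dX : RelSet → (n : ℕ) → Subset (n Data.Nat.∸ 1) → ℕ
dX X n I = length (filter (λ π → ≡-dec BoolP._≟_ (xdes X π) (toList I)) (perms n))

DesRel : RelSet
DesRel a b = b <ᵇ a

d : (n : ℕ) → Subset (n Data.Nat.∸ 1) → ℕ
d = dX DesRel

Edge : RelSet → ℕ → ℕ → Set
Edge X i j = (i ≢ j) × (X i j ≡ false)

IsTournament : RelSet → ℕ → Set
IsTournament X n = ∀ i j → 1 ≤ i → i ≤ n → 1 ≤ j → j ≤ n → i ≢ j →
  (Edge X i j × ¬ Edge X j i) ⊎ (Edge X j i × ¬ Edge X i j)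

Path : RelSet → List ℕ → Set
Path X [] = ⊤
Path X (a ∷ []) = ⊤
Path X (a ∷ b ∷ r) = Edge X a b × Path X (b ∷ r)

OddCycle : RelSet → Set
OddCycle X = Σ[ v ∈ ℕ ] Σ[ vs ∈ List ℕ ]
  All (1 ≤_) (v ∷ vs) × Unique (v ∷ vs) × (length (v ∷ vs) % 2 ≡ 1)
  × Path X ((v ∷ vs) ++ [ v ])

-- Part 1 is Rédei's theorem: a permutation has no X-descent iff it is a Hamiltonian path of the
-- tournament G_n(X), and every tournament on [n] has an odd number of Hamiltonian paths.
-- Reversing the edge between u and v turns a tournament T into T′ with
-- #HP(T) + #HP(T′) = #HP(F) + #HP(G), where F has both orientations of that edge and G neither.
-- G is the complement of the reverse of F, and complementing a digraph E never changes the parity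
-- of #HP: a permutation with k E-steps can be cut into consecutive E-paths in 2^k ways, so the
-- total number of cuttings has the parity of #HP(complement E); on the other hand cuttings into
-- at least two blocks pair off by swapping the first two blocks, and one-block cuttings are the
-- E-paths. Hence every tournament on [n] has the parity of the transitive one, which has a single
-- Hamiltonian path.
--
-- Part 2: if G(X) has no directed 3-cycle, X is a linear order on [n]; relabelling [n] by rank in
-- this order maps X-descents to descents, so d_X(I;n) = d(I;n).

module Submission where

open import Defs
open import Data.Bool using (Bool; true; false; not; _∧_; _∨_; T; if_then_else_)
import Data.Bool.Properties as Bool
open import Data.Empty using (⊥-elim)
open import Data.Fin.Subset using (Subset; ∁) renaming (⊥ to ∅)
open import Data.List
  using (List; []; _∷_; [_]; _++_; map; concat; concatMap; length; filter; replicate; reverse; reverseAcc;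
         upTo; cartesianProduct; cartesianProductWith)
open import Data.List.Properties
  using (map-++; map-∘; length-map; length-++; length-++-sucʳ; length-upTo; ++-identityʳ;
         ∷-injective; ∷-injectiveˡ; ∷-injectiveʳ; reverse-injective; ≡-dec)
open import Data.List.Membership.Propositional using (_∈_; _∉_)
open import Data.List.Membership.Propositional.Properties
  using (∈-∃++; ∈-++⁺ˡ; ∈-++⁺ʳ; ∈-++⁻; ∈-map⁺; ∈-map⁻; ∈-concat⁺′; ∈-concat⁻′; ∈-filter⁺; ∈-filter⁻;
         ∈-upTo⁺; ∈-upTo⁻; ∈-cartesianProduct⁺; ∈-cartesianProductWith⁺; ∈-cartesianProductWith⁻)
open import Data.List.Relation.Binary.Disjoint.Propositional using (Disjoint)
open import Data.List.Relation.Binary.Permutation.Propositional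
  using (_↭_; ↭-refl; ↭-sym; ↭-trans; prep; ↭⇒↭ₛ)
open import Data.List.Relation.Binary.Permutation.Propositional.Properties
  using (shift; shifts; ∈-resp-↭; ↭-length; All-resp-↭; ↭-reverse)
import Data.List.Relation.Binary.Permutation.Propositional.Properties as ↭
import Data.List.Relation.Binary.Permutation.Setoid.Properties as ↭ₛ
open import Data.List.Relation.Binary.Pointwise using (Pointwise-≡⇒≡)
open import Data.List.Relation.Binary.Subset.Propositional using (_⊆_)
open import Data.List.Relation.Unary.All as All using (All; []; _∷_)
open import Data.List.Relation.Unary.All.Properties using () renaming (map⁺ to All-map⁺)
open import Data.List.Relation.Unary.AllPairs as AllPairs using ([]; _∷_; head; tail)
open import Data.List.Relation.Unary.AllPairs.Properties using () renaming (map⁺ to AllPairs-map⁺)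
open import Data.List.Relation.Unary.Any as Any using (here; there)
open import Data.List.Relation.Unary.Any.Properties using (any⁺; any⁻)
open import Data.List.Relation.Unary.Linked as Linked using (Linked; []; [-]; _∷_)
import Data.List.Relation.Unary.Linked.Properties as Linked
open import Data.List.Relation.Unary.Sorted.TotalOrder using (Sorted)
open import Data.List.Relation.Unary.Sorted.TotalOrder.Properties using (↗↭↗⇒≋)
open import Data.List.Relation.Unary.Unique.Propositional using (Unique)
open import Data.List.Relation.Unary.Unique.Propositional.Properties
  using (Unique[x∷xs]⇒x∉xs; upTo⁺; filter⁺; cartesianProductWith⁺; ++⁺; concat⁺)
  renaming (map⁺ to Unique-map-injective⁺)
open import Data.Nat
  using (ℕ; zero; suc; _+_; _≤_; _<_; _≟_; _≡ᵇ_; _<ᵇ_; _%_; _∸_; z≤n; s≤s; parity)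
open import Data.Nat.DivMod using ([m+n]%n≡m%n)
open import Data.Nat.ListAction using (sum)
open import Data.Nat.ListAction.Properties using (sum-++; sum-↭)
open import Data.Nat.Properties
  using (≤-pred; ≤-refl; ≤-trans; ≤-reflexive; n≤1+n; n<1+n; <⇒≤; <-cmp; <-asym; <-irrefl; ≤-totalOrder;
         +-mono-≤; +-mono-≤-<; +-commutativeSemigroup; +-comm; +-suc; suc-injective; ≡ᵇ⇒≡; ≡⇒≡ᵇ; <⇒<ᵇ; <ᵇ⇒<)
open import Algebra.Properties.CommutativeSemigroup +-commutativeSemigroup
  using () renaming (interchange to +-interchange)
open import Data.Parity using (0ℙ; 1ℙ) renaming (_+_ to _⊕_)
open import Data.Parity.Properties using (+-homo-+; p+p≡0ℙ)
open import Data.Product using (_×_; _,_; proj₁; proj₂; swap)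
open import Data.Sum using (_⊎_; inj₁; inj₂)
open import Data.Unit using (tt)
open import Data.Vec using (toList)
open import Data.Vec.Properties using (toList-replicate)
open import Function using (_∘_; flip; id)
open import Function.Bundles using (Equivalence)
open import Relation.Binary.Definitions using (tri<; tri≈; tri>)
open import Relation.Binary.PropositionalEquality hiding ([_])
open import Relation.Nullary using (¬_; Dec; does; yes; no)
open import Relation.Nullary.Decidable using (T?; _×-dec_)
open import Relation.Unary using (Decidable)

private
  variable
    A B : Set

T⇒≡true : ∀ {b} → T b → b ≡ true
T⇒≡true {true} _ = refl

¬T⇒≡false : ∀ {b} → ¬ T b → b ≡ false
¬T⇒≡false {false} _ = refl
¬T⇒≡false {true} ¬b = ⊥-elim (¬b _)

T-∧⁺ : ∀ {a b} → T a → T b → T (a ∧ b)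
T-∧⁺ ta tb = Equivalence.from Bool.T-∧ (ta , tb)

T-∧⁻ : ∀ {a b} → T (a ∧ b) → T a × T b
T-∧⁻ = Equivalence.to Bool.T-∧

does-≡ : ∀ {P : Set} (P? : Dec P) {b} → (P → T b) → (T b → P) → does P? ≡ b
does-≡ (yes p) P⇒b _ = sym (T⇒≡true (P⇒b p))
does-≡ (no ¬p) _ b⇒P = sym (¬T⇒≡false (¬p ∘ b⇒P))

∈-if⁺ : ∀ {b} {xs : List A} {z} → T b → z ∈ xs → z ∈ (if b then xs else [])
∈-if⁺ {b = true} _ z∈ = z∈

∈-if⁻ : ∀ b {xs : List A} {z} → z ∈ (if b then xs else []) → T b × z ∈ xs
∈-if⁻ true z∈ = _ , z∈

𝟙 : Bool → ℕ
𝟙 true = 1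
𝟙 false = 0

𝟙-mono : ∀ {a b} → (T a → T b) → 𝟙 a ≤ 𝟙 b
𝟙-mono {false} _ = z≤n
𝟙-mono {true} {true} _ = s≤s z≤n
𝟙-mono {true} {false} a⇒b = ⊥-elim (a⇒b _)

𝟙-inclusion-exclusion : ∀ g a b → (T a → ¬ T b) →
  𝟙 (g ∧ not a) + 𝟙 (g ∧ not b) ≡ 𝟙 g + 𝟙 ((g ∧ not a) ∧ not b)
𝟙-inclusion-exclusion false _ _ _ = refl
𝟙-inclusion-exclusion true true true a⇒¬b = ⊥-elim (a⇒¬b _ _)
𝟙-inclusion-exclusion true true false _ = refl
𝟙-inclusion-exclusion true false true _ = refl
𝟙-inclusion-exclusion true false false _ = refl

⊕≡0ℙ⇒≡ : ∀ {p q} → p ⊕ q ≡ 0ℙ → p ≡ q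
⊕≡0ℙ⇒≡ {0ℙ} {0ℙ} _ = refl
⊕≡0ℙ⇒≡ {1ℙ} {1ℙ} _ = refl

parity≡1ℙ⇒%2≡1 : ∀ m → parity m ≡ 1ℙ → m % 2 ≡ 1
parity≡1ℙ⇒%2≡1 1 _ = refl
parity≡1ℙ⇒%2≡1 (suc (suc m)) odd =
  trans (trans (cong (_% 2) (+-comm 2 m)) ([m+n]%n≡m%n m 2)) (parity≡1ℙ⇒%2≡1 m odd)

∑ : (A → ℕ) → List A → ℕ
∑ f xs = sum (map f xs)

count : (A → Bool) → List A → ℕ
count p = ∑ (𝟙 ∘ p)

∑-++ : ∀ (f : A → ℕ) xs ys → ∑ f (xs ++ ys) ≡ ∑ f xs + ∑ f ys
∑-++ f xs ys = trans (cong sum (map-++ f xs ys)) (sum-++ (map f xs) (map f ys))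

∑-map : ∀ (f : B → ℕ) (g : A → B) xs → ∑ f (map g xs) ≡ ∑ (f ∘ g) xs
∑-map f g xs = cong sum (sym (map-∘ xs))

∑-↭ : ∀ (f : A → ℕ) {xs ys} → xs ↭ ys → ∑ f xs ≡ ∑ f ys
∑-↭ f xs↭ys = sum-↭ (↭.map⁺ f xs↭ys)

∑-cong : ∀ {f g : A → ℕ} xs → (∀ {x} → x ∈ xs → f x ≡ g x) → ∑ f xs ≡ ∑ g xs
∑-cong [] f≗g = refl
∑-cong (x ∷ xs) f≗g = cong₂ _+_ (f≗g (here refl)) (∑-cong xs (f≗g ∘ there))

∑-+ : ∀ (f g : A → ℕ) xs → ∑ (λ x → f x + g x) xs ≡ ∑ f xs + ∑ g xs
∑-+ f g [] = refl
∑-+ f g (x ∷ xs) = trans (cong (f x + g x +_) (∑-+ f g xs)) (+-interchange (f x) (g x) _ _)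

∑-concatMap : ∀ (f : B → ℕ) (g : A → List B) xs → ∑ f (concatMap g xs) ≡ ∑ (∑ f ∘ g) xs
∑-concatMap f g [] = refl
∑-concatMap f g (x ∷ xs) = trans (∑-++ f (g x) (concatMap g xs)) (cong (∑ f (g x) +_) (∑-concatMap f g xs))

parity-∑-cong : ∀ {f g : A → ℕ} xs → (∀ {x} → x ∈ xs → parity (f x) ≡ parity (g x)) →
  parity (∑ f xs) ≡ parity (∑ g xs)
parity-∑-cong [] f≡g = refl
parity-∑-cong {f = f} {g} (x ∷ xs) f≡g = begin
  parity (f x + ∑ f xs)           ≡⟨ +-homo-+ (f x) _ ⟩
  parity (f x) ⊕ parity (∑ f xs)  ≡⟨ cong₂ _⊕_ (f≡g (here refl)) (parity-∑-cong xs (f≡g ∘ there)) ⟩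
  parity (g x) ⊕ parity (∑ g xs)  ≡⟨ +-homo-+ (g x) _ ⟨
  parity (g x + ∑ g xs)           ∎
  where open ≡-Reasoning

length-concatMap : ∀ (g : A → List B) xs → length (concatMap g xs) ≡ ∑ (length ∘ g) xs
length-concatMap g [] = refl
length-concatMap g (x ∷ xs) = trans (length-++ (g x)) (cong (length (g x) +_) (length-concatMap g xs))

length-filter≡count : ∀ {P : A → Set} (P? : Decidable P) xs → length (filter P? xs) ≡ count (does ∘ P?) xs
length-filter≡count P? [] = refl
length-filter≡count P? (x ∷ xs) with does (P? x)
... | true = cong suc (length-filter≡count P? xs)
... | false = length-filter≡count P? xs

count-partition : ∀ (p : A → Bool) xs → count p xs + count (not ∘ p) xs ≡ length xs
count-partition p [] = refl
count-partition p (x ∷ xs) with p x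
... | true = cong suc (count-partition p xs)
... | false = trans (+-suc (count p xs) _) (cong suc (count-partition p xs))

count-true : ∀ (xs : List A) → count (λ _ → true) xs ≡ length xs
count-true [] = refl
count-true (x ∷ xs) = cong suc (count-true xs)

count-mono : ∀ {p q : A → Bool} xs → (∀ {x} → x ∈ xs → T (p x) → T (q x)) → count p xs ≤ count q xs
count-mono [] _ = z≤n
count-mono (x ∷ xs) p⇒q = +-mono-≤ (𝟙-mono (p⇒q (here refl))) (count-mono xs (p⇒q ∘ there))

count-mono-< : ∀ {p q : A → Bool} xs → (∀ {x} → x ∈ xs → T (p x) → T (q x)) →
  ∀ {y} → y ∈ xs → T (q y) → ¬ T (p y) → count p xs < count q xs
count-mono-< {p = p} {q} (y ∷ xs) p⇒q (here refl) qy ¬py with p y | q y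
... | false | true = s≤s (count-mono xs (p⇒q ∘ there))
... | true | _ = ⊥-elim (¬py _)
count-mono-< (x ∷ xs) p⇒q (there y∈xs) qy ¬py =
  +-mono-≤-< (𝟙-mono (p⇒q (here refl))) (count-mono-< xs (p⇒q ∘ there) y∈xs qy ¬py)

count-≡0 : ∀ {p : A → Bool} xs → (∀ {x} → x ∈ xs → ¬ T (p x)) → count p xs ≡ 0
count-≡0 [] _ = refl
count-≡0 {p = p} (x ∷ xs) ¬p with p x in px
... | true = ⊥-elim (¬p (here refl) (subst T (sym px) _))
... | false = count-≡0 xs (¬p ∘ there)

count-≡1 : ∀ {p : A → Bool} {xs y} → Unique xs → y ∈ xs → T (p y) →
  (∀ {x} → x ∈ xs → T (p x) → x ≡ y) → count p xs ≡ 1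
count-≡1 {p = p} {x ∷ xs} (x∉xs ∷ _) (here refl) py only with p x
... | true = cong suc (count-≡0 xs λ z∈xs pz → All.lookup x∉xs z∈xs (sym (only (there z∈xs) pz)))
count-≡1 {p = p} {x ∷ xs} (x∉xs ∷ uxs) (there y∈xs) py only with p x in px
... | true = ⊥-elim (All.lookup x∉xs y∈xs (only (here refl) (subst T (sym px) _)))
... | false = count-≡1 uxs y∈xs py (only ∘ there)

Unique-resp-↭ : ∀ {xs ys : List A} → xs ↭ ys → Unique xs → Unique ys
Unique-resp-↭ xs↭ys = ↭ₛ.Unique-resp-↭ (setoid _) (↭⇒↭ₛ xs↭ys)

Unique-map⁺ : ∀ (f : A → B) {xs} → (∀ {x y} → x ∈ xs → y ∈ xs → f x ≡ f y → x ≡ y) →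
  Unique xs → Unique (map f xs)
Unique-map⁺ f {[]} inj [] = []
Unique-map⁺ f {x ∷ xs} inj (x∉xs ∷ uxs) =
  All-map⁺ (All.tabulate λ y∈xs fx≡fy → All.lookup x∉xs y∈xs (inj (here refl) (there y∈xs) fx≡fy))
  ∷ Unique-map⁺ f (λ x∈ y∈ → inj (there x∈) (there y∈)) uxs

map-injectiveOn : ∀ {P : A → Set} (f : A → B) → (∀ {x y} → P x → P y → f x ≡ f y → x ≡ y) →
  ∀ {xs ys} → All P xs → All P ys → map f xs ≡ map f ys → xs ≡ ys
map-injectiveOn f inj [] [] _ = refl
map-injectiveOn f inj (px ∷ pxs) (py ∷ pys) fx∷fxs≡fy∷fys =
  cong₂ _∷_ (inj px py (∷-injectiveˡ fx∷fxs≡fy∷fys))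
            (map-injectiveOn f inj pxs pys (∷-injectiveʳ fx∷fxs≡fy∷fys))

unique-⊆⇒↭ : ∀ {xs ys : List A} → Unique xs → Unique ys → xs ⊆ ys → length ys ≤ length xs → xs ↭ ys
unique-⊆⇒↭ {xs = []} {[]} _ _ _ _ = ↭-refl
unique-⊆⇒↭ {xs = x ∷ xs} {ys} uxs uys xs⊆ys len with ∈-∃++ (xs⊆ys (here refl))
... | as , bs , refl =
  ↭-trans (prep x (unique-⊆⇒↭ (tail uxs) (tail (Unique-resp-↭ x∷as++bs uys)) drop-x len′)) (↭-sym x∷as++bs)
  where
  x∷as++bs : as ++ [ x ] ++ bs ↭ x ∷ as ++ bs
  x∷as++bs = shift x as bs
  drop-x : xs ⊆ as ++ bs
  drop-x z∈xs with ∈-resp-↭ x∷as++bs (xs⊆ys (there z∈xs))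
  ... | here refl = ⊥-elim (Unique[x∷xs]⇒x∉xs uxs z∈xs)
  ... | there z∈as++bs = z∈as++bs
  len′ : length (as ++ bs) ≤ length xs
  len′ = ≤-pred (subst (_≤ suc (length xs)) (length-++-sucʳ as x bs) len)

injection⇒↭ : ∀ (f : A → A) {xs} → Unique xs → (∀ {x} → x ∈ xs → f x ∈ xs) →
  (∀ {x y} → x ∈ xs → y ∈ xs → f x ≡ f y → x ≡ y) → map f xs ↭ xs
injection⇒↭ f {xs} uxs closed inj =
  unique-⊆⇒↭ (Unique-map⁺ f inj uxs) uxs image⊆ (≤-reflexive (sym (length-map f xs)))
  where
  image⊆ : map f xs ⊆ xs
  image⊆ z∈ with x , x∈ , refl ← ∈-map⁻ f z∈ = closed x∈

count-injection : ∀ (p : A → Bool) (f : A → A) {xs} → Unique xs → (∀ {x} → x ∈ xs → f x ∈ xs) →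
  (∀ {x y} → x ∈ xs → y ∈ xs → f x ≡ f y → x ≡ y) → count (p ∘ f) xs ≡ count p xs
count-injection p f {xs} uxs closed inj =
  trans (sym (∑-map (𝟙 ∘ p) f xs)) (∑-↭ (𝟙 ∘ p) (injection⇒↭ f uxs closed inj))

record FixedPointFreeInvolution (f : A → A) (xs : List A) : Set where
  field
    closed : ∀ {x} → x ∈ xs → f x ∈ xs
    involutive : ∀ {x} → x ∈ xs → f (f x) ≡ x
    fixedPointFree : ∀ {x} → x ∈ xs → f x ≢ x

FixedPointFreeInvolution-resp-↭ : ∀ {f : A → A} {xs ys} → xs ↭ ys →
  FixedPointFreeInvolution f xs → FixedPointFreeInvolution f ys
FixedPointFreeInvolution-resp-↭ {xs = xs} {ys} xs↭ys ι = record
  { closed = λ y∈ → ∈-resp-↭ xs↭ys (closed (back y∈))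
  ; involutive = λ y∈ → involutive (back y∈)
  ; fixedPointFree = λ y∈ → fixedPointFree (back y∈)
  }
  where
  open FixedPointFreeInvolution ι
  back : ∀ {y} → y ∈ ys → y ∈ xs
  back = ∈-resp-↭ (↭-sym xs↭ys)

FixedPointFreeInvolution-drop-pair : ∀ {f : A → A} {x rest} → Unique (x ∷ f x ∷ rest) →
  FixedPointFreeInvolution f (x ∷ f x ∷ rest) → FixedPointFreeInvolution f rest
FixedPointFreeInvolution-drop-pair {f = f} {x} {rest} u ι = record
  { closed = λ y∈ → stays y∈ (closed (there (there y∈)))
  ; involutive = λ y∈ → involutive (there (there y∈))
  ; fixedPointFree = λ y∈ → fixedPointFree (there (there y∈))
  }
  where
  open FixedPointFreeInvolution ι
  stays : ∀ {y} → y ∈ rest → f y ∈ x ∷ f x ∷ rest → f y ∈ rest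
  stays y∈ (here fy≡x) = ⊥-elim (All.lookup (head (tail u)) y∈
    (trans (cong f (sym fy≡x)) (involutive (there (there y∈)))))
  stays y∈ (there (here fy≡fx)) = ⊥-elim (All.lookup (head u) (there y∈)
    (trans (sym (involutive (here refl))) (trans (cong f (sym fy≡fx)) (involutive (there (there y∈))))))
  stays y∈ (there (there fy∈)) = fy∈

fixedPointFreeInvolution⇒even : ∀ {f : A → A} {xs} → Unique xs → FixedPointFreeInvolution f xs →
  parity (length xs) ≡ 0ℙ
fixedPointFreeInvolution⇒even {xs = xs} = go (length xs) ≤-refl
  where
  go : ∀ {f : A → A} k {xs} → length xs ≤ k → Unique xs → FixedPointFreeInvolution f xs →
    parity (length xs) ≡ 0ℙ
  go _ {[]} _ _ _ = refl
  go {f = f} (suc k) {x ∷ xs} len uxs ι with FixedPointFreeInvolution.closed ι (here refl)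
  ... | here fx≡x = ⊥-elim (FixedPointFreeInvolution.fixedPointFree ι (here refl) fx≡x)
  ... | there fx∈xs with as , bs , refl ← ∈-∃++ fx∈xs =
    trans (cong parity (↭-length reorder)) (go k len′ (tail (tail u)) (FixedPointFreeInvolution-drop-pair u ι′))
    where
    reorder : x ∷ as ++ [ f x ] ++ bs ↭ x ∷ f x ∷ as ++ bs
    reorder = prep x (shift (f x) as bs)
    u : Unique (x ∷ f x ∷ as ++ bs)
    u = Unique-resp-↭ reorder uxs
    ι′ : FixedPointFreeInvolution f (x ∷ f x ∷ as ++ bs)
    ι′ = FixedPointFreeInvolution-resp-↭ reorder ι
    len′ : length (as ++ bs) ≤ k
    len′ = ≤-pred (≤-trans (n≤1+n _) (subst (_≤ suc k) (↭-length reorder) len))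

∈[n]⁻ : ∀ {n x} → x ∈ [ n ]ₙ → 1 ≤ x × x ≤ n
∈[n]⁻ x∈[n] with _ , y∈upTo , refl ← ∈-map⁻ suc x∈[n] = s≤s z≤n , ∈-upTo⁻ y∈upTo

∈[n]⁺ : ∀ {n x} → 1 ≤ x → x ≤ n → x ∈ [ n ]ₙ
∈[n]⁺ {x = suc _} (s≤s z≤n) x≤n = ∈-map⁺ suc (∈-upTo⁺ x≤n)

[n]-unique : ∀ n → Unique [ n ]ₙ
[n]-unique n = Unique-map-injective⁺ suc-injective (upTo⁺ n)

length-[n] : ∀ n → length [ n ]ₙ ≡ n
length-[n] n = trans (length-map suc (upTo n)) (length-upTo n)

words-suc : ∀ n k → words n (suc k) ≡ cartesianProductWith (flip _∷_) (words n k) [ n ]ₙ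
words-suc n k = go (words n k)
  where
  go : ∀ ws → concatMap (λ w → map (_∷ w) [ n ]ₙ) ws ≡ cartesianProductWith (flip _∷_) ws [ n ]ₙ
  go [] = refl
  go (w ∷ ws) = cong (map (_∷ w) [ n ]ₙ ++_) (go ws)

∈-words⁻ : ∀ n k {w} → w ∈ words n k → length w ≡ k × All (_∈ [ n ]ₙ) w
∈-words⁻ n zero (here refl) = refl , []
∈-words⁻ n (suc k) w∈ rewrite words-suc n k
  with w′ , a , w′∈ , a∈[n] , refl ← ∈-cartesianProductWith⁻ (flip _∷_) (words n k) [ n ]ₙ w∈
  with len , w′⊆[n] ← ∈-words⁻ n k w′∈ = cong suc len , a∈[n] ∷ w′⊆[n]

∈-words⁺ : ∀ n {w} → All (_∈ [ n ]ₙ) w → w ∈ words n (length w)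
∈-words⁺ n [] = here refl
∈-words⁺ n {a ∷ w} (a∈[n] ∷ w⊆[n]) rewrite words-suc n (length w) =
  ∈-cartesianProductWith⁺ (flip _∷_) (∈-words⁺ n w⊆[n]) a∈[n]

words-unique : ∀ n k → Unique (words n k)
words-unique n zero = [] ∷ []
words-unique n (suc k) rewrite words-suc n k =
  cartesianProductWith⁺ (flip _∷_) (swap ∘ ∷-injective) (words-unique n k) ([n]-unique n)

elem⇒∈ : ∀ x ys → T (elem x ys) → x ∈ ys
elem⇒∈ x ys = Any.map (≡ᵇ⇒≡ x _) ∘ any⁻ _ ys

∈⇒elem : ∀ {x ys} → x ∈ ys → T (elem x ys)
∈⇒elem {x} = any⁺ _ ∘ Any.map (≡⇒≡ᵇ x _)

distinct⇒unique : ∀ w → T (distinct w) → Unique w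
distinct⇒unique [] _ = []
distinct⇒unique (x ∷ xs) d with elem x xs in x∈?
... | false = All.tabulate (λ y∈xs x≡y → subst T x∈? (∈⇒elem (subst (_∈ xs) (sym x≡y) y∈xs)))
              ∷ distinct⇒unique xs d

unique⇒distinct : ∀ {w} → Unique w → T (distinct w)
unique⇒distinct {[]} _ = _
unique⇒distinct {x ∷ xs} (x∉xs ∷ uxs) with elem x xs in x∈?
... | true = ⊥-elim (All.lookup x∉xs (elem⇒∈ x xs (subst T (sym x∈?) _)) refl)
... | false = unique⇒distinct uxs

record IsPerm (n : ℕ) (π : List ℕ) : Set where
  constructor isPerm
  field
    length≡n : length π ≡ n
    ⊆[n] : All (_∈ [ n ]ₙ) π
    unique : Unique π

∈-perms⁻ : ∀ n {π} → π ∈ perms n → IsPerm n π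
∈-perms⁻ n π∈ with w∈ , d ← ∈-filter⁻ (λ w → distinct w Bool.≟ true) {xs = words n n} π∈
  with len , π⊆[n] ← ∈-words⁻ n n w∈ = isPerm len π⊆[n] (distinct⇒unique _ (Equivalence.from Bool.T-≡ d))

∈-perms⁺ : ∀ {n π} → IsPerm n π → π ∈ perms n
∈-perms⁺ (isPerm refl π⊆[n] uπ) =
  ∈-filter⁺ (λ w → distinct w Bool.≟ true) (∈-words⁺ _ π⊆[n]) (Equivalence.to Bool.T-≡ (unique⇒distinct uπ))

perms-unique : ∀ n → Unique (perms n)
perms-unique n = filter⁺ _ (words-unique n n)

IsPerm-resp-↭ : ∀ {n π π′} → π ↭ π′ → IsPerm n π → IsPerm n π′
IsPerm-resp-↭ π↭π′ (isPerm len π⊆[n] uπ) =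
  isPerm (trans (sym (↭-length π↭π′)) len) (All-resp-↭ π↭π′ π⊆[n]) (Unique-resp-↭ π↭π′ uπ)

-- Hamiltonian paths

isPath : RelSet → List ℕ → Bool
isPath E [] = true
isPath E (_ ∷ []) = true
isPath E (a ∷ b ∷ r) = E a b ∧ isPath E (b ∷ r)

hamCount : ℕ → RelSet → ℕ
hamCount n E = count (isPath E) (perms n)

complement : RelSet → RelSet
complement E x y = not (E x y)

AgreeOn : ℕ → RelSet → RelSet → Set
AgreeOn n E E′ = ∀ {x y} → x ∈ [ n ]ₙ → y ∈ [ n ]ₙ → x ≢ y → E x y ≡ E′ x y

Tournament : ℕ → RelSet → Set
Tournament n E = AgreeOn n E (complement (flip E))

Tournament-asym : ∀ {n E a b} → Tournament n E → a ∈ [ n ]ₙ → b ∈ [ n ]ₙ → a ≢ b →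
  T (E a b) → ¬ T (E b a)
Tournament-asym tourE a∈ b∈ a≢b Eab Eba = subst T (trans (tourE a∈ b∈ a≢b) (cong not (T⇒≡true Eba))) Eab

Tournament-connex : ∀ {n E a b} → Tournament n E → a ∈ [ n ]ₙ → b ∈ [ n ]ₙ → a ≢ b →
  ¬ T (E a b) → T (E b a)
Tournament-connex {E = E} {a} {b} tourE a∈ b∈ a≢b ¬Eab with E b a in Eba
... | true = _
... | false = ¬Eab (subst T (sym (trans (tourE a∈ b∈ a≢b) (cong not Eba))) _)

Tournament-complement : ∀ {n E} → Tournament n E → Tournament n (complement E)
Tournament-complement tourE x∈ y∈ x≢y = cong not (tourE x∈ y∈ x≢y)

isPath-cong : ∀ {n E E′ π} → AgreeOn n E E′ → All (_∈ [ n ]ₙ) π → Unique π → isPath E π ≡ isPath E′ π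
isPath-cong {π = []} _ _ _ = refl
isPath-cong {π = _ ∷ []} _ _ _ = refl
isPath-cong {π = a ∷ b ∷ r} E≈E′ (a∈ ∷ b∈ ∷ r⊆) ((a≢b ∷ _) ∷ uπ) =
  cong₂ _∧_ (E≈E′ a∈ b∈ a≢b) (isPath-cong E≈E′ (b∈ ∷ r⊆) uπ)

hamCount-cong : ∀ {n E E′} → AgreeOn n E E′ → hamCount n E ≡ hamCount n E′
hamCount-cong {n} E≈E′ = ∑-cong (perms n) λ π∈ →
  let open IsPerm (∈-perms⁻ n π∈) in cong 𝟙 (isPath-cong E≈E′ ⊆[n] unique)

isPath-reverseAcc : ∀ E a as xs →
  isPath (flip E) (reverseAcc (a ∷ as) xs) ≡ isPath E (a ∷ xs) ∧ isPath (flip E) (a ∷ as)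
isPath-reverseAcc E a as [] = refl
isPath-reverseAcc E a as (b ∷ xs) = begin
  isPath (flip E) (reverseAcc (b ∷ a ∷ as) xs)             ≡⟨ isPath-reverseAcc E b (a ∷ as) xs ⟩
  isPath E (b ∷ xs) ∧ (E a b ∧ isPath (flip E) (a ∷ as))   ≡⟨ Bool.∧-assoc (isPath E (b ∷ xs)) _ _ ⟨
  (isPath E (b ∷ xs) ∧ E a b) ∧ isPath (flip E) (a ∷ as)
    ≡⟨ cong (_∧ isPath (flip E) (a ∷ as)) (Bool.∧-comm _ (E a b)) ⟩
  (E a b ∧ isPath E (b ∷ xs)) ∧ isPath (flip E) (a ∷ as)   ∎
  where open ≡-Reasoning

isPath-reverse : ∀ E π → isPath (flip E) (reverse π) ≡ isPath E π
isPath-reverse E [] = refl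
isPath-reverse E (a ∷ xs) = trans (isPath-reverseAcc E a [] xs) (Bool.∧-identityʳ _)

hamCount-flip : ∀ n E → hamCount n (flip E) ≡ hamCount n E
hamCount-flip n E = begin
  count (isPath (flip E)) (perms n)
    ≡⟨ count-injection (isPath (flip E)) reverse (perms-unique n) reverse-closed (λ _ _ → reverse-injective) ⟨
  count (isPath (flip E) ∘ reverse) (perms n)  ≡⟨ ∑-cong (perms n) (λ {π} _ → cong 𝟙 (isPath-reverse E π)) ⟩
  count (isPath E) (perms n)                   ∎
  where
  open ≡-Reasoning
  reverse-closed : ∀ {π} → π ∈ perms n → reverse π ∈ perms n
  reverse-closed {π} = ∈-perms⁺ ∘ IsPerm-resp-↭ (↭-sym (↭-reverse π)) ∘ ∈-perms⁻ n

isPath⇒Linked : ∀ {E π} → T (isPath E π) → Linked (λ a b → T (E a b)) π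
isPath⇒Linked {π = []} _ = []
isPath⇒Linked {π = _ ∷ []} _ = [-]
isPath⇒Linked {E} {a ∷ b ∷ r} path = proj₁ (T-∧⁻ {E a b} path) ∷ isPath⇒Linked (proj₂ (T-∧⁻ {E a b} path))

Linked⇒isPath : ∀ {E π} → Linked (λ a b → T (E a b)) π → T (isPath E π)
Linked⇒isPath [] = _
Linked⇒isPath [-] = _
Linked⇒isPath (Eab ∷ rest) = T-∧⁺ Eab (Linked⇒isPath rest)

infixl 8 _[_,_]≔_

isEdge : ℕ → ℕ → ℕ → ℕ → Bool
isEdge u v x y with x ≟ u | y ≟ v
... | yes _ | yes _ = true
... | _ | _ = false

_[_,_]≔_ : RelSet → ℕ → ℕ → Bool → RelSet
(E [ u , v ]≔ b) x y = if isEdge u v x y then b else E x y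

[]≔-hit : ∀ E u v b → (E [ u , v ]≔ b) u v ≡ b
[]≔-hit E u v b with u ≟ u | v ≟ v
... | yes _ | yes _ = refl
... | no u≢u | _ = ⊥-elim (u≢u refl)
... | yes _ | no v≢v = ⊥-elim (v≢v refl)

[]≔-miss : ∀ E u v b {x y} → ¬ (x ≡ u × y ≡ v) → (E [ u , v ]≔ b) x y ≡ E x y
[]≔-miss E u v b {x} {y} ≢uv with x ≟ u | y ≟ v
... | yes x≡u | yes y≡v = ⊥-elim (≢uv (x≡u , y≡v))
... | yes _ | no _ = refl
... | no _ | _ = refl

adjacent : ℕ → ℕ → List ℕ → Bool
adjacent u v (a ∷ b ∷ r) = isEdge u v a b ∨ adjacent u v (b ∷ r)
adjacent u v _ = false

isPath-delete : ∀ E u v π → isPath (E [ u , v ]≔ false) π ≡ isPath E π ∧ not (adjacent u v π)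
isPath-delete E u v [] = refl
isPath-delete E u v (_ ∷ []) = refl
isPath-delete E u v (a ∷ b ∷ r) rewrite isPath-delete E u v (b ∷ r) with isEdge u v a b
... | true = sym (Bool.∧-zeroʳ _)
... | false = sym (Bool.∧-assoc (E a b) _ _)

adjacent⇒∈ : ∀ u v a r → T (adjacent u v (a ∷ r)) → v ∈ r
adjacent⇒∈ u v a (b ∷ r) adj with a ≟ u | b ≟ v
... | yes _ | yes refl = here refl
... | yes _ | no _ = there (adjacent⇒∈ u v b r adj)
... | no _ | _ = there (adjacent⇒∈ u v b r adj)

adjacent-antisym : ∀ {u v π} → Unique π → u ≢ v → T (adjacent u v π) → ¬ T (adjacent v u π)
adjacent-antisym {u} {v} {a ∷ b ∷ r} (a∉ ∷ uπ) u≢v uv vu with a ≟ u | b ≟ v | a ≟ v | b ≟ u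
... | yes refl | _ | yes refl | _ = u≢v refl
... | yes refl | yes refl | no _ | _ = All.lookup a∉ (there (adjacent⇒∈ v u b r vu)) refl
... | no _ | _ | yes refl | yes refl = All.lookup a∉ (there (adjacent⇒∈ u v b r uv)) refl
... | yes _ | no _ | no _ | _ = adjacent-antisym uπ u≢v uv vu
... | no _ | _ | yes _ | no _ = adjacent-antisym uπ u≢v uv vu
... | no _ | _ | no _ | _ = adjacent-antisym uπ u≢v uv vu

hamCount-delete : ∀ n E {u v} → u ≢ v →
  hamCount n (E [ u , v ]≔ false) + hamCount n (E [ v , u ]≔ false)
  ≡ hamCount n E + hamCount n (E [ u , v ]≔ false [ v , u ]≔ false)
hamCount-delete n E {u} {v} u≢v = begin
  hamCount n (E [ u , v ]≔ false) + hamCount n (E [ v , u ]≔ false)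
    ≡⟨ ∑-+ (𝟙 ∘ isPath (E [ u , v ]≔ false)) (𝟙 ∘ isPath (E [ v , u ]≔ false)) (perms n) ⟨
  ∑ (λ π → 𝟙 (isPath (E [ u , v ]≔ false) π) + 𝟙 (isPath (E [ v , u ]≔ false) π)) (perms n)
    ≡⟨ ∑-cong (perms n) pointwise ⟩
  ∑ (λ π → 𝟙 (isPath E π) + 𝟙 (isPath (E [ u , v ]≔ false [ v , u ]≔ false) π)) (perms n)
    ≡⟨ ∑-+ (𝟙 ∘ isPath E) (𝟙 ∘ isPath (E [ u , v ]≔ false [ v , u ]≔ false)) (perms n) ⟩
  hamCount n E + hamCount n (E [ u , v ]≔ false [ v , u ]≔ false) ∎
  where
  open ≡-Reasoning
  pointwise : ∀ {π} → π ∈ perms n →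
    𝟙 (isPath (E [ u , v ]≔ false) π) + 𝟙 (isPath (E [ v , u ]≔ false) π)
    ≡ 𝟙 (isPath E π) + 𝟙 (isPath (E [ u , v ]≔ false [ v , u ]≔ false) π)
  pointwise {π} π∈
    rewrite isPath-delete (E [ u , v ]≔ false) v u π | isPath-delete E u v π | isPath-delete E v u π =
    𝟙-inclusion-exclusion (isPath E π) (adjacent u v π) (adjacent v u π)
      (adjacent-antisym (IsPerm.unique (∈-perms⁻ n π∈)) u≢v)

-- Complementation and the parity of the number of Hamiltonian paths

Blocks : Set
Blocks = List (List ℕ)

infixr 5 _◃_

_◃_ : ℕ → Blocks → Blocks
x ◃ [] = []
x ◃ (B ∷ Bs) = (x ∷ B) ∷ Bs

consSplits : ℕ → Bool → List Blocks → List Blocks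
consSplits x joins S = map ([ x ] ∷_) S ++ (if joins then map (x ◃_) S else [])

splits : RelSet → List ℕ → List Blocks
splits E [] = [ [] ]
splits E (x ∷ []) = [ [ [ x ] ] ]
splits E (x ∷ y ∷ r) = consSplits x (E x y) (splits E (y ∷ r))

IsBlock : RelSet → List ℕ → Set
IsBlock E B = B ≢ [] × T (isPath E B)

SplitsSound : RelSet → List ℕ → Set
SplitsSound E π = ∀ {Bs} → Bs ∈ splits E π → concat Bs ≡ π × All (IsBlock E) Bs

∈-splits⁻-cons : ∀ E x y r → SplitsSound E (y ∷ r) → SplitsSound E (x ∷ y ∷ r)
∈-splits⁻-cons E x y r ih Bs∈ with ∈-++⁻ (map ([ x ] ∷_) (splits E (y ∷ r))) Bs∈
... | inj₁ Bs∈₁ with Bs′ , Bs′∈ , refl ← ∈-map⁻ ([ x ] ∷_) Bs∈₁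
  with concat≡ , blocks ← ih Bs′∈ = cong (x ∷_) concat≡ , ((λ ()) , _) ∷ blocks
... | inj₂ Bs∈₂ with Exy , Bs∈₃ ← ∈-if⁻ (E x y) Bs∈₂
  with Bs′ , Bs′∈ , refl ← ∈-map⁻ (x ◃_) Bs∈₃
  with concat≡ , blocks ← ih Bs′∈
  with Bs′ | concat≡ | blocks
... | [] ∷ _ | _ | ([]≢[] , _) ∷ _ = ⊥-elim ([]≢[] refl)
... | (y ∷ B) ∷ R | refl | (_ , path) ∷ blocks′ = refl , ((λ ()) , T-∧⁺ Exy path) ∷ blocks′

∈-splits⁻ : ∀ E π → SplitsSound E π
∈-splits⁻ E [] (here refl) = refl , []
∈-splits⁻ E (x ∷ []) (here refl) = refl , ((λ ()) , _) ∷ []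
∈-splits⁻ E (x ∷ y ∷ r) = ∈-splits⁻-cons E x y r (∈-splits⁻ E (y ∷ r))

∈-splits⁺ : ∀ E B R → IsBlock E B → All (IsBlock E) R → B ∷ R ∈ splits E (B ++ concat R)
∈-splits⁺ E [] R ([]≢[] , _) _ = ⊥-elim ([]≢[] refl)
∈-splits⁺ E (x ∷ []) [] _ _ = here refl
∈-splits⁺ E (x ∷ []) ([] ∷ R) _ (([]≢[] , _) ∷ _) = ⊥-elim ([]≢[] refl)
∈-splits⁺ E (x ∷ []) ((y ∷ C) ∷ R) _ (okC ∷ okR) =
  ∈-++⁺ˡ (∈-map⁺ ([ x ] ∷_) (∈-splits⁺ E (y ∷ C) R okC okR))
∈-splits⁺ E (x ∷ y ∷ B) R (_ , path) okR =
  ∈-++⁺ʳ (map ([ x ] ∷_) (splits E (y ∷ B ++ concat R)))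
    (∈-if⁺ (proj₁ (T-∧⁻ path)) (∈-map⁺ (x ◃_) (∈-splits⁺ E (y ∷ B) R ((λ ()) , proj₂ (T-∧⁻ path)) okR)))

∈-splits-concat : ∀ E {Bs} → All (IsBlock E) Bs → Bs ∈ splits E (concat Bs)
∈-splits-concat E [] = here refl
∈-splits-concat E {B ∷ R} (okB ∷ okR) = ∈-splits⁺ E B R okB okR

splits-unique-cons : ∀ E x y r → Unique (splits E (y ∷ r)) → Unique (splits E (x ∷ y ∷ r))
splits-unique-cons E x y r uS =
  ++⁺ (Unique-map-injective⁺ ∷-injectiveʳ uS) (unique-if (E x y) (Unique-map-injective⁺ ◃-injective uS))
    disjoint
  where
  S : List Blocks
  S = splits E (y ∷ r)
  ◃-injective : ∀ {Bs Cs} → x ◃ Bs ≡ x ◃ Cs → Bs ≡ Cs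
  ◃-injective {[]} {[]} _ = refl
  ◃-injective {_ ∷ _} {_ ∷ _} refl = refl
  unique-if : ∀ b {xs : List Blocks} → Unique xs → Unique (if b then xs else [])
  unique-if true u = u
  unique-if false _ = []
  disjoint : Disjoint (map ([ x ] ∷_) S) (if E x y then map (x ◃_) S else [])
  disjoint (Bs∈₁ , Bs∈₂)
    with _ , Bs∈₃ ← ∈-if⁻ (E x y) Bs∈₂
    with Cs , Cs∈ , Bs≡x◃Cs ← ∈-map⁻ (x ◃_) Bs∈₃
    with _ , _ , refl ← ∈-map⁻ ([ x ] ∷_) Bs∈₁
    with Cs | Bs≡x◃Cs | ∈-splits⁻ E (y ∷ r) Cs∈
  ... | [] ∷ _ | _ | _ , ([]≢[] , _) ∷ _ = []≢[] refl
  ... | (_ ∷ _) ∷ _ | () | _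

splits-unique : ∀ E π → Unique (splits E π)
splits-unique E [] = [] ∷ []
splits-unique E (x ∷ []) = [] ∷ []
splits-unique E (x ∷ y ∷ r) = splits-unique-cons E x y r (splits-unique E (y ∷ r))

parity-length-join : ∀ b q x (S : List Blocks) → parity (length S) ≡ parity (𝟙 q) →
  parity (length (consSplits x b S)) ≡ parity (𝟙 (not b ∧ q))
parity-length-join true q x S _ = begin
  parity (length (map ([ x ] ∷_) S ++ map (x ◃_) S))   ≡⟨ cong parity (length-++ (map ([ x ] ∷_) S)) ⟩
  parity (length (map ([ x ] ∷_) S) + length (map (x ◃_) S))
    ≡⟨ cong parity (cong₂ _+_ (length-map ([ x ] ∷_) S) (length-map (x ◃_) S)) ⟩
  parity (length S + length S)                        ≡⟨ +-homo-+ (length S) (length S) ⟩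
  parity (length S) ⊕ parity (length S)               ≡⟨ p+p≡0ℙ (parity (length S)) ⟩
  0ℙ                                                  ∎
  where open ≡-Reasoning
parity-length-join false q x S ih = begin
  parity (length (map ([ x ] ∷_) S ++ []))  ≡⟨ cong (parity ∘ length) (++-identityʳ (map ([ x ] ∷_) S)) ⟩
  parity (length (map ([ x ] ∷_) S))        ≡⟨ cong parity (length-map ([ x ] ∷_) S) ⟩
  parity (length S)                         ≡⟨ ih ⟩
  parity (𝟙 q)                              ∎
  where open ≡-Reasoning

-- splits E π has 2^k elements, k the number of E-steps of π.
parity-length-splits : ∀ E π → parity (length (splits E π)) ≡ parity (𝟙 (isPath (complement E) π))
parity-length-splits E [] = refl
parity-length-splits E (x ∷ []) = refl
parity-length-splits E (x ∷ y ∷ r) =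
  parity-length-join (E x y) _ x (splits E (y ∷ r)) (parity-length-splits E (y ∷ r))

multiple : Blocks → Bool
multiple (_ ∷ _ ∷ _) = true
multiple _ = false

multiple-◃ : ∀ x Bs → multiple (x ◃ Bs) ≡ multiple Bs
multiple-◃ x [] = refl
multiple-◃ x (_ ∷ []) = refl
multiple-◃ x (_ ∷ _ ∷ _) = refl

count-single-join : ∀ b q x (S : List Blocks) → (∀ {Bs} → Bs ∈ S → Bs ≢ []) →
  count (not ∘ multiple) S ≡ 𝟙 q →
  count (not ∘ multiple) (consSplits x b S) ≡ 𝟙 (b ∧ q)
count-single-join b q x S nonempty ih =
  trans (∑-++ (𝟙 ∘ not ∘ multiple) (map ([ x ] ∷_) S) _)
        (cong₂ _+_ (trans (∑-map (𝟙 ∘ not ∘ multiple) ([ x ] ∷_) S) (count-≡0 S prepended-multiple)) (joined b))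
  where
  prepended-multiple : ∀ {Bs} → Bs ∈ S → ¬ T (not (multiple ([ x ] ∷ Bs)))
  prepended-multiple {[]} Bs∈ = ⊥-elim (nonempty Bs∈ refl)
  prepended-multiple {_ ∷ _} _ ()
  joined : ∀ b → count (not ∘ multiple) (if b then map (x ◃_) S else []) ≡ 𝟙 (b ∧ q)
  joined false = refl
  joined true = begin
    count (not ∘ multiple) (map (x ◃_) S)   ≡⟨ ∑-map (𝟙 ∘ not ∘ multiple) (x ◃_) S ⟩
    count (not ∘ multiple ∘ (x ◃_)) S       ≡⟨ ∑-cong S (λ {Bs} _ → cong (𝟙 ∘ not) (multiple-◃ x Bs)) ⟩
    count (not ∘ multiple) S                ≡⟨ ih ⟩
    𝟙 q                                     ∎
    where open ≡-Reasoning

count-single-splits : ∀ E π → count (not ∘ multiple) (splits E π) ≡ 𝟙 (isPath E π)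
count-single-splits E [] = refl
count-single-splits E (x ∷ []) = refl
count-single-splits E (x ∷ y ∷ r) =
  count-single-join (E x y) _ x (splits E (y ∷ r)) nonempty (count-single-splits E (y ∷ r))
  where
  nonempty : ∀ {Bs} → Bs ∈ splits E (y ∷ r) → Bs ≢ []
  nonempty Bs∈ refl with () ← proj₁ (∈-splits⁻ E (y ∷ r) Bs∈)

blockSeqs : ℕ → RelSet → List Blocks
blockSeqs n E = concatMap (splits E) (perms n)

∈-blockSeqs⁻ : ∀ n E {Bs} → Bs ∈ blockSeqs n E → IsPerm n (concat Bs) × All (IsBlock E) Bs
∈-blockSeqs⁻ n E Bs∈
  with _ , Bs∈splits , splits∈ ← ∈-concat⁻′ (map (splits E) (perms n)) Bs∈
  with π , π∈ , refl ← ∈-map⁻ (splits E) splits∈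
  with refl , blocks ← ∈-splits⁻ E π Bs∈splits = ∈-perms⁻ n π∈ , blocks

∈-blockSeqs⁺ : ∀ n E {Bs} → IsPerm n (concat Bs) → All (IsBlock E) Bs → Bs ∈ blockSeqs n E
∈-blockSeqs⁺ n E perm blocks = ∈-concat⁺′ (∈-splits-concat E blocks) (∈-map⁺ (splits E) (∈-perms⁺ perm))

blockSeqs-unique : ∀ n E → Unique (blockSeqs n E)
blockSeqs-unique n E = concat⁺
  (All-map⁺ (All.tabulate (λ {π} _ → splits-unique E π)))
  (AllPairs-map⁺ (AllPairs.map disjoint (perms-unique n)))
  where
  disjoint : ∀ {π π′} → π ≢ π′ → Disjoint (splits E π) (splits E π′)
  disjoint π≢π′ (Bs∈ , Bs∈′) = π≢π′ (trans (sym (proj₁ (∈-splits⁻ E _ Bs∈))) (proj₁ (∈-splits⁻ E _ Bs∈′)))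

swapBlocks : Blocks → Blocks
swapBlocks (B ∷ C ∷ Bs) = C ∷ B ∷ Bs
swapBlocks Bs = Bs

swapBlocks-involutive : ∀ Bs → swapBlocks (swapBlocks Bs) ≡ Bs
swapBlocks-involutive [] = refl
swapBlocks-involutive (_ ∷ []) = refl
swapBlocks-involutive (_ ∷ _ ∷ _) = refl

swapBlocks-fixedPointFree : ∀ n E → FixedPointFreeInvolution swapBlocks (filter (T? ∘ multiple) (blockSeqs n E))
swapBlocks-fixedPointFree n E = record
  { closed = closed
  ; involutive = λ {Bs} _ → swapBlocks-involutive Bs
  ; fixedPointFree = fixedPointFree
  }
  where
  M : List Blocks
  M = filter (T? ∘ multiple) (blockSeqs n E)
  closed : ∀ {Bs} → Bs ∈ M → swapBlocks Bs ∈ M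
  closed {Bs} Bs∈M with Bs∈ , multi ← ∈-filter⁻ (T? ∘ multiple) Bs∈M with Bs | multi | ∈-blockSeqs⁻ n E Bs∈
  ... | B ∷ C ∷ R | _ | perm , okB ∷ okC ∷ okR =
    ∈-filter⁺ (T? ∘ multiple) (∈-blockSeqs⁺ n E (IsPerm-resp-↭ (shifts B C) perm) (okC ∷ okB ∷ okR)) _
  fixedPointFree : ∀ {Bs} → Bs ∈ M → swapBlocks Bs ≢ Bs
  fixedPointFree {Bs} Bs∈M with Bs∈ , multi ← ∈-filter⁻ (T? ∘ multiple) Bs∈M with Bs | multi | ∈-blockSeqs⁻ n E Bs∈
  ... | [] ∷ _ ∷ _ | _ | _ , ([]≢[] , _) ∷ _ = λ _ → []≢[] refl
  ... | (b ∷ B) ∷ C ∷ R | _ | isPerm _ _ ((b∉ ∷ _)) , _ = λ { refl → All.lookup b∉ (∈-++⁺ʳ B (here refl)) refl }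

hamCount-complement : ∀ n E → parity (hamCount n (complement E)) ≡ parity (hamCount n E)
hamCount-complement n E = begin
  parity (hamCount n (complement E))        ≡⟨ parity-∑-cong P (λ {π} _ → sym (parity-length-splits E π)) ⟩
  parity (∑ (length ∘ splits E) P)          ≡⟨ cong parity (length-concatMap (splits E) P) ⟨
  parity (length L)                         ≡⟨ cong parity (count-partition multiple L) ⟨
  parity (count multiple L + count (not ∘ multiple) L)
    ≡⟨ +-homo-+ (count multiple L) _ ⟩
  parity (count multiple L) ⊕ parity (count (not ∘ multiple) L)
    ≡⟨ cong₂ _⊕_ multiple-even (cong parity singles) ⟩
  parity (hamCount n E)                     ∎
  where
  open ≡-Reasoning
  P : List (List ℕ)
  P = perms n
  L : List Blocks
  L = blockSeqs n E
  multiple-even : parity (count multiple L) ≡ 0ℙ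
  multiple-even = trans (cong parity (sym (length-filter≡count (T? ∘ multiple) L)))
    (fixedPointFreeInvolution⇒even (filter⁺ (T? ∘ multiple) (blockSeqs-unique n E))
                                   (swapBlocks-fixedPointFree n E))
  singles : count (not ∘ multiple) L ≡ hamCount n E
  singles = trans (∑-concatMap (𝟙 ∘ not ∘ multiple) (splits E) P) (∑-cong P (λ {π} _ → count-single-splits E π))

-- Rédei's theorem

AgreeExcept : ℕ → ℕ → ℕ → RelSet → RelSet → Set
AgreeExcept n u v E E′ = ∀ {x y} → x ∈ [ n ]ₙ → y ∈ [ n ]ₙ → x ≢ y →
  ¬ (x ≡ u × y ≡ v) → ¬ (x ≡ v × y ≡ u) → E x y ≡ E′ x y

module Reorientation {n T T′ u v} (tourT : Tournament n T) (tourT′ : Tournament n T′) (u≢v : u ≢ v)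
  (Tuv : T u v ≡ true) (T′uv : T′ u v ≡ false) (T≈T′ : AgreeExcept n u v T T′) where

  open ≡-Reasoning

  F : RelSet
  F = T [ v , u ]≔ true

  private
    vu≢uv : ¬ (v ≡ u × u ≡ v)
    vu≢uv (v≡u , _) = u≢v (sym v≡u)
    uv≢vu : ¬ (u ≡ v × v ≡ u)
    uv≢vu (u≡v , _) = u≢v u≡v

  T≈F∖vu : AgreeOn n T (F [ v , u ]≔ false)
  T≈F∖vu {x} {y} x∈ y∈ x≢y with (x ≟ v) ×-dec (y ≟ u)
  ... | yes (refl , refl) = trans (tourT x∈ y∈ x≢y) (trans (cong not Tuv) (sym ([]≔-hit F v u false)))
  ... | no xy≢vu = sym (trans ([]≔-miss F v u false xy≢vu) ([]≔-miss T v u true xy≢vu))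

  T′≈F∖uv : AgreeOn n T′ (F [ u , v ]≔ false)
  T′≈F∖uv {x} {y} x∈ y∈ x≢y with (x ≟ u) ×-dec (y ≟ v) | (x ≟ v) ×-dec (y ≟ u)
  ... | yes (refl , refl) | _ = trans T′uv (sym ([]≔-hit F u v false))
  ... | no _ | yes (refl , refl) = begin
    T′ v u                         ≡⟨ tourT′ x∈ y∈ x≢y ⟩
    not (T′ u v)                   ≡⟨ cong not T′uv ⟩
    true                           ≡⟨ []≔-hit T v u true ⟨
    F v u                          ≡⟨ []≔-miss F u v false vu≢uv ⟨
    (F [ u , v ]≔ false) v u       ∎
  ... | no xy≢uv | no xy≢vu = begin
    T′ x y                         ≡⟨ T≈T′ x∈ y∈ x≢y xy≢uv xy≢vu ⟨
    T x y                          ≡⟨ []≔-miss T v u true xy≢vu ⟨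
    F x y                          ≡⟨ []≔-miss F u v false xy≢uv ⟨
    (F [ u , v ]≔ false) x y       ∎

  F∖both≈complement : AgreeOn n (F [ u , v ]≔ false [ v , u ]≔ false) (complement (flip F))
  F∖both≈complement {x} {y} x∈ y∈ x≢y with (x ≟ u) ×-dec (y ≟ v) | (x ≟ v) ×-dec (y ≟ u)
  ... | yes (refl , refl) | _ = begin
    (F [ u , v ]≔ false [ v , u ]≔ false) u v   ≡⟨ []≔-miss (F [ u , v ]≔ false) v u false uv≢vu ⟩
    (F [ u , v ]≔ false) u v                    ≡⟨ []≔-hit F u v false ⟩
    false                                       ≡⟨ cong not ([]≔-hit T v u true) ⟨
    not (F v u)                                 ∎
  ... | no _ | yes (refl , refl) = begin
    (F [ u , v ]≔ false [ v , u ]≔ false) v u   ≡⟨ []≔-hit (F [ u , v ]≔ false) v u false ⟩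
    false                                       ≡⟨ cong not Tuv ⟨
    not (T u v)                                 ≡⟨ cong not ([]≔-miss T v u true uv≢vu) ⟨
    not (F u v)                                 ∎
  ... | no xy≢uv | no xy≢vu = begin
    (F [ u , v ]≔ false [ v , u ]≔ false) x y   ≡⟨ []≔-miss (F [ u , v ]≔ false) v u false xy≢vu ⟩
    (F [ u , v ]≔ false) x y                    ≡⟨ []≔-miss F u v false xy≢uv ⟩
    F x y                                       ≡⟨ []≔-miss T v u true xy≢vu ⟩
    T x y                                       ≡⟨ tourT x∈ y∈ x≢y ⟩
    not (T y x)
      ≡⟨ cong not ([]≔-miss T v u true (λ (y≡v , x≡u) → xy≢uv (x≡u , y≡v))) ⟨
    not (F y x)                                 ∎

  parity-F∖both : parity (hamCount n (F [ u , v ]≔ false [ v , u ]≔ false)) ≡ parity (hamCount n F)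
  parity-F∖both = begin
    parity (hamCount n (F [ u , v ]≔ false [ v , u ]≔ false))
      ≡⟨ cong parity (hamCount-cong F∖both≈complement) ⟩
    parity (hamCount n (complement (flip F)))                   ≡⟨ hamCount-complement n (flip F) ⟩
    parity (hamCount n (flip F))                                ≡⟨ cong parity (hamCount-flip n F) ⟩
    parity (hamCount n F)                                       ∎

  parity-hamCount-reorient : parity (hamCount n T) ≡ parity (hamCount n T′)
  parity-hamCount-reorient = ⊕≡0ℙ⇒≡ (begin
    parity (hamCount n T) ⊕ parity (hamCount n T′)    ≡⟨ +-homo-+ (hamCount n T) _ ⟨
    parity (hamCount n T + hamCount n T′)
      ≡⟨ cong parity (cong₂ _+_ (hamCount-cong T≈F∖vu) (hamCount-cong T′≈F∖uv)) ⟩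
    parity (hamCount n (F [ v , u ]≔ false) + hamCount n (F [ u , v ]≔ false))
      ≡⟨ cong parity (trans (+-comm (hamCount n (F [ v , u ]≔ false)) _) (hamCount-delete n F u≢v)) ⟩
    parity (hamCount n F + hamCount n (F [ u , v ]≔ false [ v , u ]≔ false))
      ≡⟨ +-homo-+ (hamCount n F) _ ⟩
    parity (hamCount n F) ⊕ parity (hamCount n (F [ u , v ]≔ false [ v , u ]≔ false))
      ≡⟨ cong (parity (hamCount n F) ⊕_) parity-F∖both ⟩
    parity (hamCount n F) ⊕ parity (hamCount n F)     ≡⟨ p+p≡0ℙ (parity (hamCount n F)) ⟩
    0ℙ                                                ∎)

parity-hamCount-AgreeExcept : ∀ {n E E′ u v} → Tournament n E → Tournament n E′ → AgreeExcept n u v E E′ →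
  parity (hamCount n E) ≡ parity (hamCount n E′)
parity-hamCount-AgreeExcept {n} {E} {E′} {u} {v} tourE tourE′ E≈E′ with u ≟ v
... | yes refl = cong parity (hamCount-cong λ x∈ y∈ x≢y →
  E≈E′ x∈ y∈ x≢y (λ (x≡u , y≡u) → x≢y (trans x≡u (sym y≡u))) (λ (x≡u , y≡u) → x≢y (trans x≡u (sym y≡u))))
... | no u≢v with E u v Bool.≟ E′ u v
... | yes Euv≡E′uv = cong parity (hamCount-cong agree)
  where
  agree : AgreeOn n E E′
  agree {x} {y} x∈ y∈ x≢y with (x ≟ u) ×-dec (y ≟ v) | (x ≟ v) ×-dec (y ≟ u)
  ... | yes (refl , refl) | _ = Euv≡E′uv
  ... | no _ | yes (refl , refl) =
    trans (tourE x∈ y∈ x≢y) (trans (cong not Euv≡E′uv) (sym (tourE′ x∈ y∈ x≢y)))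
  ... | no xy≢uv | no xy≢vu = E≈E′ x∈ y∈ x≢y xy≢uv xy≢vu
... | no Euv≢E′uv with E u v in Euv | E′ u v in E′uv
... | true | false = Reorientation.parity-hamCount-reorient tourE tourE′ u≢v Euv E′uv E≈E′
... | false | true = sym (Reorientation.parity-hamCount-reorient tourE′ tourE u≢v E′uv Euv
  (λ x∈ y∈ x≢y xy≢uv xy≢vu → sym (E≈E′ x∈ y∈ x≢y xy≢uv xy≢vu)))
... | true | true = ⊥-elim (Euv≢E′uv refl)
... | false | false = ⊥-elim (Euv≢E′uv refl)

AgreeOutside : ℕ → List (ℕ × ℕ) → RelSet → RelSet → Set
AgreeOutside n L E E′ = ∀ {x y} → x ∈ [ n ]ₙ → y ∈ [ n ]ₙ → x ≢ y → (x , y) ∉ L → (y , x) ∉ L → E x y ≡ E′ x y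

module CopyOrientation {n E E′} (u v : ℕ) (tourE : Tournament n E) (tourE′ : Tournament n E′) where

  E″ : RelSet
  E″ = E′ [ u , v ]≔ E u v [ v , u ]≔ E v u

  E″-vu : E″ v u ≡ E v u
  E″-vu = []≔-hit (E′ [ u , v ]≔ E u v) v u (E v u)

  E″-uv : u ≢ v → E″ u v ≡ E u v
  E″-uv u≢v = trans ([]≔-miss (E′ [ u , v ]≔ E u v) v u _ (λ (u≡v , _) → u≢v u≡v)) ([]≔-hit E′ u v (E u v))

  E″-other : ∀ {x y} → ¬ (x ≡ u × y ≡ v) → ¬ (x ≡ v × y ≡ u) → E″ x y ≡ E′ x y
  E″-other xy≢uv xy≢vu = trans ([]≔-miss (E′ [ u , v ]≔ E u v) v u _ xy≢vu) ([]≔-miss E′ u v _ xy≢uv)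

  E″≈E′ : AgreeExcept n u v E″ E′
  E″≈E′ _ _ _ = E″-other

  tourE″ : Tournament n E″
  tourE″ {x} {y} x∈ y∈ x≢y with (x ≟ u) ×-dec (y ≟ v) | (x ≟ v) ×-dec (y ≟ u)
  ... | yes (refl , refl) | _ = trans (E″-uv x≢y) (trans (tourE x∈ y∈ x≢y) (cong not (sym E″-vu)))
  ... | no _ | yes (refl , refl) =
    trans E″-vu (trans (tourE x∈ y∈ x≢y) (cong not (sym (E″-uv (x≢y ∘ sym)))))
  ... | no xy≢uv | no xy≢vu = trans (E″-other xy≢uv xy≢vu) (trans (tourE′ x∈ y∈ x≢y)
    (cong not (sym (E″-other (λ (y≡u , x≡v) → xy≢vu (x≡v , y≡u)) (λ (y≡v , x≡u) → xy≢uv (x≡u , y≡v))))))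

  E≈E″ : ∀ L → AgreeOutside n ((u , v) ∷ L) E E′ → AgreeOutside n L E E″
  E≈E″ L E≈E′ {x} {y} x∈ y∈ x≢y xy∉L yx∉L with (x ≟ u) ×-dec (y ≟ v) | (x ≟ v) ×-dec (y ≟ u)
  ... | yes (refl , refl) | _ = sym (E″-uv x≢y)
  ... | no _ | yes (refl , refl) = sym E″-vu
  ... | no xy≢uv | no xy≢vu = trans
    (E≈E′ x∈ y∈ x≢y (λ { (here refl) → xy≢uv (refl , refl) ; (there xy∈L) → xy∉L xy∈L })
                    (λ { (here refl) → xy≢vu (refl , refl) ; (there yx∈L) → yx∉L yx∈L }))
    (sym (E″-other xy≢uv xy≢vu))

parity-hamCount-AgreeOutside : ∀ {n} L {E E′} → Tournament n E → Tournament n E′ → AgreeOutside n L E E′ →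
  parity (hamCount n E) ≡ parity (hamCount n E′)
parity-hamCount-AgreeOutside [] tourE tourE′ E≈E′ =
  cong parity (hamCount-cong λ x∈ y∈ x≢y → E≈E′ x∈ y∈ x≢y (λ ()) (λ ()))
parity-hamCount-AgreeOutside ((u , v) ∷ L) tourE tourE′ E≈E′ =
  trans (parity-hamCount-AgreeOutside L tourE tourE″ (E≈E″ L E≈E′))
        (parity-hamCount-AgreeExcept tourE″ tourE′ E″≈E′)
  where open CopyOrientation u v tourE tourE′

parity-hamCount-Tournament : ∀ n {E E′} → Tournament n E → Tournament n E′ →
  parity (hamCount n E) ≡ parity (hamCount n E′)
parity-hamCount-Tournament n tourE tourE′ =
  parity-hamCount-AgreeOutside (cartesianProduct [ n ]ₙ [ n ]ₙ) tourE tourE′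
  λ x∈ y∈ _ xy∉ _ → ⊥-elim (xy∉ (∈-cartesianProduct⁺ x∈ y∈))

<ᵇ-Tournament : ∀ n → Tournament n _<ᵇ_
<ᵇ-Tournament n {x} {y} _ _ x≢y with <-cmp x y
... | tri< x<y _ y≮x = trans (T⇒≡true (<⇒<ᵇ x<y)) (cong not (sym (¬T⇒≡false (y≮x ∘ <ᵇ⇒< y x))))
... | tri≈ _ x≡y _ = ⊥-elim (x≢y x≡y)
... | tri> x≮y _ y<x = trans (¬T⇒≡false (x≮y ∘ <ᵇ⇒< x y)) (cong not (sym (T⇒≡true (<⇒<ᵇ y<x))))

hamCount-<ᵇ : ∀ n → hamCount n _<ᵇ_ ≡ 1
hamCount-<ᵇ n = count-≡1 (perms-unique n) (∈-perms⁺ [n]-perm) (Linked⇒isPath [n]-increasing) only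
  where
  [n]-perm : IsPerm n [ n ]ₙ
  [n]-perm = isPerm (length-[n] n) (All.tabulate id) ([n]-unique n)
  [n]-increasing : Linked (λ a b → T (a <ᵇ b)) [ n ]ₙ
  [n]-increasing = Linked.map⁺ (Linked.applyUpTo⁺₁ id n λ {i} _ → <⇒<ᵇ (n<1+n i))
  sorted : ∀ {π} → Linked (λ a b → T (a <ᵇ b)) π → Sorted ≤-totalOrder π
  sorted = Linked.map (λ {a} {b} a<b → <⇒≤ (<ᵇ⇒< a b a<b))
  only : ∀ {π} → π ∈ perms n → T (isPath _<ᵇ_ π) → π ≡ [ n ]ₙ
  only π∈ increasing with isPerm len π⊆[n] uπ ← ∈-perms⁻ n π∈ =
    Pointwise-≡⇒≡ (↗↭↗⇒≋ ≤-totalOrder (sorted (isPath⇒Linked increasing)) (sorted [n]-increasing)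
      (↭⇒↭ₛ (unique-⊆⇒↭ uπ ([n]-unique n) (All.lookup π⊆[n]) (≤-reflexive (trans (length-[n] n) (sym len))))))

rédei : ∀ n {E} → Tournament n E → parity (hamCount n E) ≡ 1ℙ
rédei n tourE = trans (parity-hamCount-Tournament n tourE (<ᵇ-Tournament n)) (cong parity (hamCount-<ᵇ n))

-- Relabelling and transitive tournaments

module _ (n : ℕ) (σ : ℕ → ℕ) (σ-∈ : ∀ {a} → a ∈ [ n ]ₙ → σ a ∈ [ n ]ₙ)
  (σ-injective : ∀ {a b} → a ∈ [ n ]ₙ → b ∈ [ n ]ₙ → σ a ≡ σ b → a ≡ b) where

  xdes-map : ∀ E E′ → (∀ {a b} → a ∈ [ n ]ₙ → b ∈ [ n ]ₙ → a ≢ b → E′ (σ a) (σ b) ≡ E a b) →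
    ∀ {π} → All (_∈ [ n ]ₙ) π → Unique π → xdes E′ (map σ π) ≡ xdes E π
  xdes-map E E′ relabel {[]} _ _ = refl
  xdes-map E E′ relabel {_ ∷ []} _ _ = refl
  xdes-map E E′ relabel {a ∷ b ∷ r} (a∈ ∷ b∈ ∷ r⊆) ((a≢b ∷ _) ∷ uπ) =
    cong₂ _∷_ (relabel a∈ b∈ a≢b) (xdes-map E E′ relabel (b∈ ∷ r⊆) uπ)

  map-σ-∈-perms : ∀ {π} → π ∈ perms n → map σ π ∈ perms n
  map-σ-∈-perms {π} π∈ with isPerm len π⊆[n] uπ ← ∈-perms⁻ n π∈ = ∈-perms⁺ (isPerm
    (trans (length-map σ π) len) (All-map⁺ (All.map σ-∈ π⊆[n]))
    (Unique-map⁺ σ (λ a∈ b∈ → σ-injective (All.lookup π⊆[n] a∈) (All.lookup π⊆[n] b∈)) uπ))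

  dX-relabel : ∀ E E′ → (∀ {a b} → a ∈ [ n ]ₙ → b ∈ [ n ]ₙ → a ≢ b → E′ (σ a) (σ b) ≡ E a b) →
    ∀ I → dX E n I ≡ dX E′ n I
  dX-relabel E E′ relabel I = begin
    dX E n I                                     ≡⟨ length-filter≡count (xdes≟ E) (perms n) ⟩
    count (does ∘ xdes≟ E) (perms n)             ≡⟨ ∑-cong (perms n) (cong 𝟙 ∘ xdes≟-relabel) ⟨
    count (does ∘ xdes≟ E′ ∘ map σ) (perms n)
      ≡⟨ count-injection (does ∘ xdes≟ E′) (map σ) (perms-unique n) map-σ-∈-perms map-σ-injective ⟩
    count (does ∘ xdes≟ E′) (perms n)            ≡⟨ length-filter≡count (xdes≟ E′) (perms n) ⟨
    dX E′ n I                                    ∎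
    where
    open ≡-Reasoning
    xdes≟ : ∀ E π → Dec (xdes E π ≡ toList I)
    xdes≟ E π = ≡-dec Bool._≟_ (xdes E π) (toList I)
    xdes≟-relabel : ∀ {π} → π ∈ perms n → does (xdes≟ E′ (map σ π)) ≡ does (xdes≟ E π)
    xdes≟-relabel π∈ = let open IsPerm (∈-perms⁻ n π∈) in
      cong (λ w → does (≡-dec Bool._≟_ w (toList I))) (xdes-map E E′ relabel ⊆[n] unique)
    map-σ-injective : ∀ {π π′} → π ∈ perms n → π′ ∈ perms n → map σ π ≡ map σ π′ → π ≡ π′
    map-σ-injective π∈ π′∈ =
      map-injectiveOn σ σ-injective (IsPerm.⊆[n] (∈-perms⁻ n π∈)) (IsPerm.⊆[n] (∈-perms⁻ n π′∈))

TransitiveOn : ℕ → RelSet → Set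
TransitiveOn n E = ∀ {a b c} → a ∈ [ n ]ₙ → b ∈ [ n ]ₙ → c ∈ [ n ]ₙ → a ≢ b → b ≢ c → a ≢ c →
  T (E a b) → T (E b c) → T (E a c)

module Rank (n : ℕ) (E : RelSet) (tourE : Tournament n E) (transE : TransitiveOn n E) where

  below : ℕ → ℕ → Bool
  below a j = E a j ∧ not (j ≡ᵇ a)

  rank : ℕ → ℕ
  rank a = suc (count (below a) [ n ]ₙ)

  below⁻ : ∀ {a j} → T (below a j) → T (E a j) × j ≢ a
  below⁻ {a} {j} h with E a j | j ≡ᵇ a in j≡ᵇa
  ... | true | false = _ , λ j≡a → subst T j≡ᵇa (≡⇒≡ᵇ j a j≡a)

  below⁺ : ∀ {a j} → T (E a j) → j ≢ a → T (below a j)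
  below⁺ {a} {j} Eaj j≢a with E a j | j ≡ᵇ a in j≡ᵇa
  ... | true | false = _
  ... | true | true = j≢a (≡ᵇ⇒≡ j a (subst T (sym j≡ᵇa) _))

  ¬below-self : ∀ a → ¬ T (below a a)
  ¬below-self a h = proj₂ (below⁻ h) refl

  rank-< : ∀ {a b} → a ∈ [ n ]ₙ → b ∈ [ n ]ₙ → a ≢ b → T (E a b) → rank b < rank a
  rank-< {a} {b} a∈ b∈ a≢b Eab =
    s≤s (count-mono-< [ n ]ₙ below-b⇒below-a b∈ (below⁺ Eab (a≢b ∘ sym)) (¬below-self b))
    where
    below-b⇒below-a : ∀ {j} → j ∈ [ n ]ₙ → T (below b j) → T (below a j)
    below-b⇒below-a {j} j∈ h with Ebj , j≢b ← below⁻ h =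
      below⁺ (transE a∈ b∈ j∈ a≢b (j≢b ∘ sym) (j≢a ∘ sym) Eab Ebj) j≢a
      where
      j≢a : j ≢ a
      j≢a refl = Tournament-asym tourE a∈ b∈ a≢b Eab Ebj

  rank-∈ : ∀ {a} → a ∈ [ n ]ₙ → rank a ∈ [ n ]ₙ
  rank-∈ {a} a∈ = ∈[n]⁺ (s≤s z≤n) (≤-trans
    (count-mono-< [ n ]ₙ (λ _ _ → _) a∈ _ (¬below-self a))
    (≤-reflexive (trans (count-true [ n ]ₙ) (length-[n] n))))

  rank-relabel : ∀ {a b} → a ∈ [ n ]ₙ → b ∈ [ n ]ₙ → a ≢ b → DesRel (rank a) (rank b) ≡ E a b
  rank-relabel {a} {b} a∈ b∈ a≢b with E a b in Eab
  ... | true = T⇒≡true (<⇒<ᵇ (rank-< a∈ b∈ a≢b (subst T (sym Eab) _)))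
  ... | false = ¬T⇒≡false λ ra<rb → <-asym (<ᵇ⇒< _ _ ra<rb)
    (rank-< b∈ a∈ (a≢b ∘ sym) (Tournament-connex tourE a∈ b∈ a≢b (subst T Eab)))

  rank-injective : ∀ {a b} → a ∈ [ n ]ₙ → b ∈ [ n ]ₙ → rank a ≡ rank b → a ≡ b
  rank-injective {a} {b} a∈ b∈ ra≡rb with a ≟ b
  ... | yes a≡b = a≡b
  ... | no a≢b with E a b in Eab
  ... | true = ⊥-elim (<-irrefl (sym ra≡rb) (rank-< a∈ b∈ a≢b (subst T (sym Eab) _)))
  ... | false = ⊥-elim (<-irrefl ra≡rb (rank-< b∈ a∈ (a≢b ∘ sym) (Tournament-connex tourE a∈ b∈ a≢b (subst T Eab))))

  dX≡d : ∀ I → dX E n I ≡ d n I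
  dX≡d = dX-relabel n rank rank-∈ rank-injective E DesRel rank-relabel

-- Descents and the graphs G_n(X)

xdes≡replicate⇒isPath : ∀ X π → xdes X π ≡ replicate (length π ∸ 1) false → T (isPath (complement X) π)
xdes≡replicate⇒isPath X [] _ = _
xdes≡replicate⇒isPath X (_ ∷ []) _ = _
xdes≡replicate⇒isPath X (a ∷ b ∷ r) eq =
  T-∧⁺ (Equivalence.from Bool.T-not-≡ (∷-injectiveˡ eq)) (xdes≡replicate⇒isPath X (b ∷ r) (∷-injectiveʳ eq))

isPath⇒xdes≡replicate : ∀ X π → T (isPath (complement X) π) → xdes X π ≡ replicate (length π ∸ 1) false
isPath⇒xdes≡replicate X [] _ = refl
isPath⇒xdes≡replicate X (_ ∷ []) _ = refl
isPath⇒xdes≡replicate X (a ∷ b ∷ r) path = cong₂ _∷_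
  (Equivalence.to Bool.T-not-≡ (proj₁ (T-∧⁻ {not (X a b)} path)))
  (isPath⇒xdes≡replicate X (b ∷ r) (proj₂ (T-∧⁻ {not (X a b)} path)))

dX-∅ : ∀ X n → dX X n ∅ ≡ hamCount n (complement X)
dX-∅ X n = trans (length-filter≡count xdes≟∅ (perms n)) (∑-cong (perms n) (cong 𝟙 ∘ xdes≟∅-isPath))
  where
  xdes≟∅ : ∀ π → Dec (xdes X π ≡ toList (∅ {n ∸ 1}))
  xdes≟∅ π = ≡-dec Bool._≟_ (xdes X π) (toList (∅ {n ∸ 1}))
  xdes≟∅-isPath : ∀ {π} → π ∈ perms n → does (xdes≟∅ π) ≡ isPath (complement X) π
  xdes≟∅-isPath {π} π∈ rewrite toList-replicate (n ∸ 1) false | sym (IsPerm.length≡n (∈-perms⁻ n π∈)) =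
    does-≡ (≡-dec Bool._≟_ (xdes X π) _) (xdes≡replicate⇒isPath X π) (isPath⇒xdes≡replicate X π)

IsTournament⇒Tournament : ∀ {X} → (∀ n → 1 ≤ n → IsTournament X n) → ∀ n → Tournament n X
IsTournament⇒Tournament {X} hT n {x} {y} x∈ y∈ x≢y =
  exactlyOne (hT n (≤-trans 1≤x x≤n) x y 1≤x x≤n 1≤y y≤n x≢y)
  where
  1≤x : 1 ≤ x
  1≤x = proj₁ (∈[n]⁻ x∈)
  x≤n : x ≤ n
  x≤n = proj₂ (∈[n]⁻ x∈)
  1≤y : 1 ≤ y
  1≤y = proj₁ (∈[n]⁻ y∈)
  y≤n : y ≤ n
  y≤n = proj₂ (∈[n]⁻ y∈)
  exactlyOne : (Edge X x y × ¬ Edge X y x) ⊎ (Edge X y x × ¬ Edge X x y) → X x y ≡ not (X y x)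
  exactlyOne (inj₁ ((_ , Xxy≡false) , ¬Eyx)) with X y x
  ... | true = Xxy≡false
  ... | false = ⊥-elim (¬Eyx ((x≢y ∘ sym) , refl))
  exactlyOne (inj₂ ((_ , Xyx≡false) , ¬Exy)) rewrite Xyx≡false with X x y
  ... | true = refl
  ... | false = ⊥-elim (¬Exy (x≢y , refl))

-- A failure of transitivity at a → b → c is the directed 3-cycle b → a → c → b of G(X).
noOddCycle⇒TransitiveOn : ∀ {X n} → Tournament n X → ¬ OddCycle X → TransitiveOn n X
noOddCycle⇒TransitiveOn {X} {n} tourX noCycle {a} {b} {c} a∈ b∈ c∈ a≢b b≢c a≢c Xab Xbc with X a c in Xac
... | true = _
... | false = noCycle (b , a ∷ c ∷ [] , (pos b∈ ∷ pos a∈ ∷ pos c∈ ∷ []) ,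
  ((b≢a ∷ b≢c ∷ []) ∷ (a≢c ∷ []) ∷ [] ∷ []) , refl , (b≢a , Xba) , (a≢c , Xac) , ((b≢c ∘ sym) , Xcb) , tt)
  where
  pos : ∀ {x} → x ∈ [ n ]ₙ → 1 ≤ x
  pos = proj₁ ∘ ∈[n]⁻
  b≢a : b ≢ a
  b≢a = a≢b ∘ sym
  Xba : X b a ≡ false
  Xba = trans (tourX b∈ a∈ b≢a) (cong not (T⇒≡true Xab))
  Xcb : X c b ≡ false
  Xcb = trans (tourX c∈ b∈ (b≢c ∘ sym)) (cong not (T⇒≡true Xbc))

corollary3p5 : (X : RelSet) → (∀ n → 1 ≤ n → IsTournament X n) →
    ((n : ℕ) → dX X n ∅ % 2 ≡ 1)
    × (¬ OddCycle X → (n : ℕ) → (I : Subset (n ∸ 1)) →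
        (dX X n I ≡ d n I) ⊎ (dX X n I ≡ d n (∁ I)))
corollary3p5 X hT = part1 , part2
  where
  tourX : ∀ n → Tournament n X
  tourX = IsTournament⇒Tournament hT
  part1 : ∀ n → dX X n ∅ % 2 ≡ 1
  part1 n = parity≡1ℙ⇒%2≡1 (dX X n ∅)
    (trans (cong parity (dX-∅ X n)) (rédei n (Tournament-complement (tourX n))))
  part2 : ¬ OddCycle X → ∀ n I → (dX X n I ≡ d n I) ⊎ (dX X n I ≡ d n (∁ I))
  part2 noCycle n I = inj₁ (Rank.dX≡d n X (tourX n) (noOddCycle⇒TransitiveOn (tourX n) noCycle) I)
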